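{- Let $G=(V,E)$ be a connected digraph. Then $$\tilde{\mathcal Q}_G=\{\mathbf x\in\mathbb R^V \mid f_{C^*}(\mathbf x)\ge0 \text{ for all elementary directed cuts } C^* \text{ of } G;\ \ell\cdot\mathbf x\le1 \text{ for all admissible layerings } \ell \text{ of } G;\ \mathbf 1\cdot\mathbf x=0\}.$$
   Context: For an edge $e=\overrightarrow{th}$, $\mathbf x_e=\mathbf 1_h-\mathbf 1_t$; $\tilde{\mathcal Q}_G=\mathrm{conv}(\{\mathbf 0\}\cup\{\mathbf x_e\mid e\in E\})$; $\mathbf 1=\sum_{v}\mathbf 1_v$. A cut is a nonempty edge set consisting of the edges between $V_0$ and $V_1$ for a partition $V=V_0\sqcup V_1$; it is elementary if minimal among cuts under inclusion, and directed if all its edges point to the same shore; for a directed cut we let $V_1$ be the shore containing the heads. The functional $f_{C^*}$ is the linear functional with $f_{C^*}(\mathbf 1_v)=1$ for $v\in V_1$ and $0$ for $v\in V_0$. A function $\ell:V\to\mathbb Z$ (viewed as a vector in $\mathbb R^V$) is an admissible layering if $\ell(h)-\ell(t)\le1$ for every edge $\overrightarrow{th}$ and the edges with $\ell(h)-\ell(t)=1$ form a weakly connected spanning subgraph of $G$ (i.e., together with all vertices, connected when orientations are ignored).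
   Formalization: The points $\mathbf x$ have rational coordinates, lying in ℚ^V rather than ℝ^V, and the coefficients of the convex combinations defining $\tilde{\mathcal Q}_G$ are rational. -}

module Defs where

open import Data.Nat using (ℕ; zero; suc)
open import Data.Fin using (Fin; zero; suc; _≟_)
open import Data.Bool using (Bool; true; false)
open import Data.Integer as ℤ using (ℤ)
open import Data.Rational as ℚ using (ℚ; 0ℚ; 1ℚ; _+_; _*_; _-_; _/_)
open import Data.Product using (Σ; ∃; _×_; _,_; proj₁; proj₂)
open import Data.List using (List; []; _∷_; length; map; lookup)
open import Data.List.Membership.Propositional using (_∈_)
open import Data.List.Relation.Unary.Any using (Any)
open import Relation.Binary.PropositionalEquality using (_≡_; _≢_)
open import Relation.Nullary using (yes; no)

-- A digraph on vertex set V = Fin n, given by its list of edges (tail , head).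
-- (Multi-edges allowed.)
Edge : ℕ → Set
Edge n = Fin n × Fin n

tail head : ∀ {n} → Edge n → Fin n
tail = proj₁
head = proj₂

Vect : ℕ → Set
Vect n = Fin n → ℚ

sumV : ∀ {n} → (Fin n → ℚ) → ℚ
sumV {zero}  f = 0ℚ
sumV {suc n} f = f zero + sumV (λ i → f (suc i))

ind : ∀ {n} → Fin n → Vect n
ind v w with v ≟ w
... | yes _ = 1ℚ
... | no  _ = 0ℚ

xE : ∀ {n} → Edge n → Vect n
xE (t , h) w = ind h w - ind t w

zeroV : ∀ {n} → Vect n
zeroV _ = 0ℚ

InConv : ∀ {n} → List (Vect n) → Vect n → Set
InConv {n} ps x =
  Σ (Fin (length ps) → ℚ) λ λs →
    (∀ i → 0ℚ ℚ.≤ λs i) ×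
    (sumFin λs ≡ 1ℚ) ×
    (∀ w → x w ≡ sumFin (λ i → λs i * lookup ps i w))
  where
    sumFin : ∀ {k} → (Fin k → ℚ) → ℚ
    sumFin = sumV

InQtilde : ∀ {n} → List (Edge n) → Vect n → Set
InQtilde E x = InConv (zeroV ∷ map xE E) x

data WConn {n} (E : List (Edge n)) (P : Edge n → Set) : Fin n → Fin n → Set where
  here : ∀ {u} → WConn E P u u
  fwd  : ∀ {t h w} → (t , h) ∈ E → P (t , h) → WConn E P h w → WConn E P t w
  bwd  : ∀ {t h w} → (t , h) ∈ E → P (t , h) → WConn E P t w → WConn E P h w

data ⊤' : Set where
  tt' : ⊤'

Connected : ∀ {n} → List (Edge n) → Set
Connected {n} E = ∀ (u v : Fin n) → WConn E (λ _ → ⊤') u v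

-- Partitions V = V0 ⊔ V1 are given by S : V → Bool (S v ≡ true iff v ∈ V1).
-- Edge e lies in the cut of S iff its endpoints are on different shores.
Crosses : ∀ {n} → (Fin n → Bool) → Edge n → Set
Crosses S (t , h) = S t ≢ S h

IsCut : ∀ {n} → List (Edge n) → (Fin n → Bool) → Set
IsCut E S = Any (Crosses S) E

CutSubset : ∀ {n} → List (Edge n) → (Fin n → Bool) → (Fin n → Bool) → Set
CutSubset {n} E S' S = ∀ (e : Edge n) → e ∈ E → Crosses S' e → Crosses S e

IsElementaryCut : ∀ {n} → List (Edge n) → (Fin n → Bool) → Set
IsElementaryCut {n} E S =
  IsCut E S × (∀ (S' : Fin n → Bool) → IsCut E S' → CutSubset E S' S → CutSubset E S S')

DirectedToV1 : ∀ {n} → List (Edge n) → (Fin n → Bool) → Set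
DirectedToV1 {n} E S =
  ∀ (e : Edge n) → e ∈ E → Crosses S e → (S (tail e) ≡ false) × (S (head e) ≡ true)

fCut : ∀ {n} → (Fin n → Bool) → Vect n → ℚ
fCut S x = sumV (λ v → sel (S v) (x v))
  where
    sel : Bool → ℚ → ℚ
    sel true  q = q
    sel false _ = 0ℚ

dotℤ : ∀ {n} → (Fin n → ℤ) → Vect n → ℚ
dotℤ ℓ x = sumV (λ v → (ℓ v / 1) * x v)

Tight : ∀ {n} → (Fin n → ℤ) → Edge n → Set
Tight ℓ (t , h) = ℓ h ℤ.- ℓ t ≡ ℤ.+ 1

IsAdmissibleLayering : ∀ {n} → List (Edge n) → (Fin n → ℤ) → Set
IsAdmissibleLayering {n} E ℓ =
  (∀ (e : Edge n) → e ∈ E → ℓ (head e) ℤ.- ℓ (tail e) ℤ.≤ ℤ.+ 1) ×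
  (∀ (u v : Fin n) → WConn E (Tight ℓ) u v)

InRHS : ∀ {n} → List (Edge n) → Vect n → Set
InRHS {n} E x =
  (∀ (S : Fin n → Bool) → IsElementaryCut E S → DirectedToV1 E S → 0ℚ ℚ.≤ fCut S x) ×
  (∀ (ℓ : Fin n → ℤ) → IsAdmissibleLayering E ℓ → dotℤ ℓ x ℚ.≤ 1ℚ) ×
  (sumV x ≡ 0ℚ)

{-# OPTIONS --safe #-}
-- ⊆: every defining inequality is linear and holds at 0 and at each x_e.
-- ⊇: if x ∉ Q̃_G, Farkas' lemma (proved by Fourier–Motzkin elimination) yields m : ℚ^V with
-- m(h) − m(t) ≤ 1 on every edge and m · x > 1. Let K be the set of vertices joined to a root r
-- by edges that are tight for m (m(h) − m(t) = 1). If K = V, then m − m(r) is an integral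
-- admissible layering ℓ with ℓ · x = m · x > 1 (as 𝟏 · x = 0), a contradiction. Otherwise the
-- component C of G − K containing some v ∉ K gives an elementary cut whose edges all join C to K.
-- The cut inequality (if the cut is directed) or f_C(x) + f_{V∖C}(x) = 𝟏 · x = 0 gives a shore U
-- with f_U(x) ≥ 0 and an edge entering U. Raising m on U by the least slack of these edges keeps
-- m a layering, does not decrease m · x, keeps K tight and makes an edge leaving K tight, so K
-- grows strictly; this cannot go on forever.
module Submission where

open import Defs
open import Algebra.Bundles using (CommutativeRing)
open import Data.Bool using (Bool; true; false; not; if_then_else_)
open import Data.Bool.Properties using (not-injective; not-involutive; ¬-not) renaming (_≟_ to _≟ᵇ_)
open import Data.Empty using (⊥; ⊥-elim)
open import Data.Fin as Fin using (Fin; zero; suc)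
open import Data.Fin.Properties using (suc-injective; all?; ¬∀⟶∃¬)
open import Data.Fin.Subset using (∣_∣)
open import Data.Fin.Subset.Properties using (∣p∣≤n; p⊂q⇒∣p∣<∣q∣)
open import Data.Integer as ℤ using (ℤ)
import Data.Integer.Properties as ℤₚ
open import Data.List using (List; _∷_; _++_; map; length; lookup; filter; cartesianProductWith; tabulate)
import Data.List.Extrema
open import Data.List.Membership.Propositional using (_∈_; find; lose)
open import Data.List.Membership.Propositional.Properties
  using (∈-map⁺; ∈-map⁻; ∈-lookup; ∈-++⁺ˡ; ∈-++⁺ʳ; ∈-++⁻; ∈-filter⁺; ∈-filter⁻;
         ∈-cartesianProductWith⁺; ∈-cartesianProductWith⁻; ∈-tabulate⁺; ∈-tabulate⁻)
open import Data.List.Relation.Unary.All as All using (All)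
open import Data.List.Relation.Unary.All.Properties using (map⁺)
open import Data.List.Relation.Unary.Any as Any using (Any; here; there; any?; index)
open import Data.List.Relation.Unary.Any.Properties using (lookup-index)
open import Data.Nat as ℕ using (ℕ; zero; suc; s≤s; z≤n; _∸_)
import Data.Nat.Coprimality as Coprime
open import Data.Nat.Induction using (<-wellFounded)
import Data.Nat.Properties as ℕₚ
open import Data.Product using (Σ; ∃; _×_; _,_; proj₁; proj₂)
open import Data.Rational as ℚ using (ℚ; mkℚ; 0ℚ; 1ℚ; ½; _+_; _*_; _-_; -_; _≤_; _<_; _/_; 1/_; ↥_)
open import Data.Rational.Properties
open import Data.Rational.Solver using (module +-*-Solver)
open import Data.Sum using (_⊎_; inj₁; inj₂; [_,_]′)
import Data.Vec as Vec
import Data.Vec.Functional as V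
open import Data.Vec.Properties using (lookup∘tabulate; []=⇒lookup; lookup⇒[]=)
open import Function using (_∘_; id)
open import Induction.WellFounded using (WellFounded; Acc; acc; module Subrelation)
open import Relation.Binary.Bundles using (DecTotalOrder)
import Relation.Binary.Construct.On as On
open import Relation.Binary.Definitions using (tri<; tri≈; tri>)
open import Relation.Binary.PropositionalEquality
open import Relation.Nullary using (¬_; Dec; yes; no; ¬?; _×-dec_)
open import Relation.Nullary.Decidable using (decidable-stable)

open import Algebra.Properties.Semiring.Sum (CommutativeRing.semiring +-*-commutativeRing)
  using (sum; sum-syntax; sum-cong-≗; ∑-distrib-+; ∑-comm; *-distribˡ-sum; *-distribʳ-sum; sum-replicate-zero)
open import Algebra.Properties.Group +-0-group
  using (inverseʳ-unique) renaming (⁻¹-involutive to neg-involutive)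
open Data.List.Extrema (DecTotalOrder.totalOrder ≤-decTotalOrder)
  using (min; max; min≤v⁺; max≤v⁺; v≤max⁺; argmin; argmin-sel; f[argmin]≤f[xs])
open +-*-Solver

-- recip 0ℚ = 0ℚ is a junk value; every lemma about recip assumes a nonzero argument.
recip : ℚ → ℚ
recip q with q ≟ 0ℚ
... | yes _   = 0ℚ
... | no q≢0 = (1/ q) {{ℚ.≢-nonZero q≢0}}

*-recipʳ : ∀ q → q ≢ 0ℚ → q * recip q ≡ 1ℚ
*-recipʳ q q≢0 with q ≟ 0ℚ
... | yes q≡0 = ⊥-elim (q≢0 q≡0)
... | no q≢0′ = *-inverseʳ q {{ℚ.≢-nonZero q≢0′}}

recip-pos : ∀ {q} → 0ℚ < q → 0ℚ < recip q
recip-pos {q} q>0 with q ≟ 0ℚ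
... | yes q≡0 = ⊥-elim (<-irrefl (sym q≡0) q>0)
... | no _    = positive⁻¹ _ {{1/pos⇒pos q {{ℚ.positive q>0}}}}

recip-neg : ∀ {q} → q < 0ℚ → recip q < 0ℚ
recip-neg {q} q<0 with q ≟ 0ℚ
... | yes q≡0 = ⊥-elim (<-irrefl q≡0 q<0)
... | no _    = negative⁻¹ _ {{1/neg⇒neg q {{ℚ.negative q<0}}}}

*-nonNeg : ∀ {p q} → 0ℚ ≤ p → 0ℚ ≤ q → 0ℚ ≤ p * q
*-nonNeg {p} {q} p≥0 q≥0 =
  nonNegative⁻¹ _ {{nonNeg*nonNeg⇒nonNeg p {{ℚ.nonNegative p≥0}} q {{ℚ.nonNegative q≥0}}}}

p≤q⇒0≤q-p : ∀ {p q} → p ≤ q → 0ℚ ≤ q - p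
p≤q⇒0≤q-p {p} {q} p≤q = subst (_≤ q - p) (+-inverseʳ p) (+-monoˡ-≤ (- p) p≤q)

≤-‿⇒+≤ : ∀ {p q r} → p ≤ r - q → p + q ≤ r
≤-‿⇒+≤ {p} {q} {r} p≤r-q =
  subst (p + q ≤_) (solve 2 (λ q r → r :- q :+ q := r) refl q r) (+-monoˡ-≤ q p≤r-q)

/1≡mkℚ : ∀ i → i / 1 ≡ mkℚ i 0 (Coprime.sym (Coprime.1-coprimeTo _))
/1≡mkℚ i = ↥p/↧p≡p (mkℚ i 0 (Coprime.sym (Coprime.1-coprimeTo _)))

/1-injective : ∀ {i j} → i / 1 ≡ j / 1 → i ≡ j
/1-injective {i} {j} eq = cong ↥_ (trans (sym (/1≡mkℚ i)) (trans eq (/1≡mkℚ j)))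

/1-homo-+ : ∀ i j → (i ℤ.+ j) / 1 ≡ i / 1 + j / 1
/1-homo-+ i j = trans
  (/-cong {p₁ = i ℤ.+ j} {q₁ = 1} {p₂ = i ℤ.* ℤ.+ 1 ℤ.+ j ℤ.* ℤ.+ 1} {q₂ = 1}
    (sym (cong₂ ℤ._+_ (ℤₚ.*-identityʳ i) (ℤₚ.*-identityʳ j))) refl)
  (sym (cong₂ _+_ (/1≡mkℚ i) (/1≡mkℚ j)))

/1-homo-‿- : ∀ i j → (i ℤ.- j) / 1 ≡ i / 1 - j / 1
/1-homo-‿- i j = trans (/1-homo-+ i (ℤ.- j)) (cong (i / 1 +_) (inverseʳ-unique (j / 1) _ j-j≡0))
  where
  j-j≡0 : j / 1 + (ℤ.- j) / 1 ≡ 0ℚ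
  j-j≡0 = trans (sym (/1-homo-+ j (ℤ.- j))) (cong (_/ 1) (ℤₚ.+-inverseʳ j))

/1-mono-≤ : ∀ {i j} → i ℤ.≤ j → i / 1 ≤ j / 1
/1-mono-≤ {i} {j} i≤j = subst₂ _≤_ (sym (/1≡mkℚ i)) (sym (/1≡mkℚ j))
  (ℚ.*≤* (subst₂ ℤ._≤_ (sym (ℤₚ.*-identityʳ i)) (sym (ℤₚ.*-identityʳ j)) i≤j))

/1-cancel-≤ : ∀ {i j} → i / 1 ≤ j / 1 → i ℤ.≤ j
/1-cancel-≤ {i} {j} i≤j = subst₂ ℤ._≤_ (ℤₚ.*-identityʳ i) (ℤₚ.*-identityʳ j)
  (drop-*≤* (subst₂ _≤_ (/1≡mkℚ i) (/1≡mkℚ j) i≤j))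

sumV≡sum : ∀ {n} (f : Vect n) → sumV f ≡ sum f
sumV≡sum {zero}  f = refl
sumV≡sum {suc n} f = cong (f zero +_) (sumV≡sum (f ∘ suc))

∑-neg : ∀ {n} (f : Vect n) → ∑[ i < n ] (- f i) ≡ - sum f
∑-neg {zero}  f = refl
∑-neg {suc n} f = trans (cong (- f zero +_) (∑-neg (f ∘ suc))) (sym (neg-distrib-+ (f zero) _))

∑-mono-≤ : ∀ {n} {f g : Vect n} → (∀ i → f i ≤ g i) → sum f ≤ sum g
∑-mono-≤ {zero}  f≤g = ≤-refl
∑-mono-≤ {suc n} f≤g = +-mono-≤ (f≤g zero) (∑-mono-≤ (f≤g ∘ suc))

ind-self : ∀ {n} (i : Fin n) → ind i i ≡ 1ℚ
ind-self i with i Fin.≟ i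
... | yes _  = refl
... | no i≢i = ⊥-elim (i≢i refl)

ind-other : ∀ {n} {i j : Fin n} → i ≢ j → ind i j ≡ 0ℚ
ind-other {i = i} {j} i≢j with i Fin.≟ j
... | yes i≡j = ⊥-elim (i≢j i≡j)
... | no _    = refl

ind-suc : ∀ {n} (i j : Fin n) → ind (suc i) (suc j) ≡ ind i j
ind-suc i j = by-cases (i Fin.≟ j)
  where
  by-cases : ∀ {i j} → Dec (i ≡ j) → ind (suc i) (suc j) ≡ ind i j
  by-cases {i} (yes refl) = trans (ind-self (suc i)) (sym (ind-self i))
  by-cases (no i≢j)       = trans (ind-other (i≢j ∘ suc-injective)) (sym (ind-other i≢j))

ind-nonNeg : ∀ {n} (i j : Fin n) → 0ℚ ≤ ind i j
ind-nonNeg i j with i Fin.≟ j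
... | yes _ = nonNegative⁻¹ 1ℚ
... | no _  = ≤-refl

∑-ind : ∀ {n} (i : Fin n) (f : Vect n) → ∑[ j < n ] (ind i j * f j) ≡ f i
∑-ind {suc n} zero f = begin
  1ℚ * f zero + ∑[ j < n ] (ind zero (suc j) * f (suc j))
    ≡⟨ cong₂ _+_ (*-identityˡ (f zero)) (sum-cong-≗ (λ j → *-zeroˡ (f (suc j)))) ⟩
  f zero + ∑[ j < n ] 0ℚ
    ≡⟨ trans (cong (f zero +_) (sum-replicate-zero n)) (+-identityʳ (f zero)) ⟩
  f zero ∎
  where open ≡-Reasoning
∑-ind {suc n} (suc i) f = begin
  0ℚ * f zero + ∑[ j < n ] (ind (suc i) (suc j) * f (suc j))
    ≡⟨ cong₂ _+_ (*-zeroˡ (f zero)) (sum-cong-≗ (λ j → cong (_* f (suc j)) (ind-suc i j))) ⟩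
  0ℚ + ∑[ j < n ] (ind i j * f (suc j))
    ≡⟨ trans (+-identityˡ _) (∑-ind i (f ∘ suc)) ⟩
  f (suc i) ∎
  where open ≡-Reasoning

infix 7 _·_

_·_ : ∀ {n} → Vect n → Vect n → ℚ
a · y = sum (λ i → a i * y i)

·-comm : ∀ {n} (a y : Vect n) → a · y ≡ y · a
·-comm a y = sum-cong-≗ (λ i → *-comm (a i) (y i))

·-zeroʳ : ∀ {n} (a : Vect n) → a · zeroV ≡ 0ℚ
·-zeroʳ {n} a = trans (sum-cong-≗ (λ i → *-zeroʳ (a i))) (sum-replicate-zero n)

·-distribʳ-+ : ∀ {n} (a b y : Vect n) → (λ i → a i + b i) · y ≡ a · y + b · y
·-distribʳ-+ a b y = trans (sum-cong-≗ (λ i → *-distribʳ-+ (y i) (a i) (b i)))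
                           (∑-distrib-+ (λ i → a i * y i) (λ i → b i * y i))

·-scaleˡ : ∀ {n} q (a y : Vect n) → (λ i → q * a i) · y ≡ q * (a · y)
·-scaleˡ q a y = trans (sum-cong-≗ (λ i → *-assoc q (a i) (y i))) (sym (*-distribˡ-sum q (λ i → a i * y i)))

·-xE : ∀ {n} (c : Vect n) (t h : Fin n) → c · xE (t , h) ≡ c h - c t
·-xE c t h = begin
  sum (λ w → c w * (ind h w - ind t w))
    ≡⟨ sum-cong-≗ (λ w → distrib (c w) (ind h w) (ind t w)) ⟩
  sum (λ w → ind h w * c w + - (ind t w * c w))
    ≡⟨ ∑-distrib-+ (λ w → ind h w * c w) (λ w → - (ind t w * c w)) ⟩
  sum (λ w → ind h w * c w) + sum (λ w → - (ind t w * c w))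
    ≡⟨ cong₂ _+_ (∑-ind h c) (trans (∑-neg (λ w → ind t w * c w)) (cong -_ (∑-ind t c))) ⟩
  c h - c t ∎
  where
  open ≡-Reasoning
  distrib : ∀ c a b → c * (a - b) ≡ a * c + - (b * c)
  distrib = solve 3 (λ c a b → c :* (a :- b) := a :* c :+ (:- (b :* c))) refl

·-convex-combination : ∀ {n k} (λs : Fin k → ℚ) (ps : Fin k → Vect n) {x : Vect n} →
  (∀ w → x w ≡ sum (λ i → λs i * ps i w)) → ∀ c → c · x ≡ sum (λ i → λs i * (c · ps i))
·-convex-combination λs ps {x} x≡ c = begin
  sum (λ w → c w * x w)
    ≡⟨ sum-cong-≗ (λ w → cong (c w *_) (x≡ w)) ⟩
  sum (λ w → c w * sum (λ i → λs i * ps i w))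
    ≡⟨ sum-cong-≗ (λ w → *-distribˡ-sum (c w) (λ i → λs i * ps i w)) ⟩
  sum (λ w → sum (λ i → c w * (λs i * ps i w)))
    ≡⟨ ∑-comm (λ w i → c w * (λs i * ps i w)) ⟩
  sum (λ i → sum (λ w → c w * (λs i * ps i w)))
    ≡⟨ sum-cong-≗ (λ i → sum-cong-≗ (λ w → reorder (c w) (λs i) (ps i w))) ⟩
  sum (λ i → sum (λ w → λs i * (c w * ps i w)))
    ≡⟨ sum-cong-≗ (λ i → sym (*-distribˡ-sum (λs i) (λ w → c w * ps i w))) ⟩
  sum (λ i → λs i * (c · ps i)) ∎
  where
  open ≡-Reasoning
  reorder : ∀ a b d → a * (b * d) ≡ b * (a * d)
  reorder = solve 3 (λ a b d → a :* (b :* d) := b :* (a :* d)) refl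

module _ {n : ℕ} {ps : List (Vect n)} {x : Vect n} (c : Vect n) {β : ℚ} where

  conv-≤ : (∀ p → p ∈ ps → c · p ≤ β) → InConv ps x → c · x ≤ β
  conv-≤ bound (λs , λs≥0 , ∑λs≡1 , x≡) = begin
    c · x                                 ≡⟨ ·-convex-combination λs (lookup ps) x≡′ c ⟩
    sum (λ i → λs i * (c · lookup ps i))  ≤⟨ ∑-mono-≤ (λ i → *-monoˡ-≤-nonNeg (λs i) {{λs≥0′ i}} (bound _ (∈-lookup i))) ⟩
    sum (λ i → λs i * β)                  ≡⟨ *-distribʳ-sum β λs ⟨
    sum λs * β                            ≡⟨ cong (_* β) (trans (sym (sumV≡sum λs)) ∑λs≡1) ⟩
    1ℚ * β                                ≡⟨ *-identityˡ β ⟩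
    β                                     ∎
    where
    open ≤-Reasoning
    x≡′ = λ w → trans (x≡ w) (sumV≡sum (λ i → λs i * lookup ps i w))
    λs≥0′ = λ i → ℚ.nonNegative (λs≥0 i)

  conv-≥ : (∀ p → p ∈ ps → β ≤ c · p) → InConv ps x → β ≤ c · x
  conv-≥ bound (λs , λs≥0 , ∑λs≡1 , x≡) = begin
    β                                     ≡⟨ *-identityˡ β ⟨
    1ℚ * β                                ≡⟨ cong (_* β) (trans (sym ∑λs≡1) (sumV≡sum λs)) ⟩
    sum λs * β                            ≡⟨ *-distribʳ-sum β λs ⟩
    sum (λ i → λs i * β)                  ≤⟨ ∑-mono-≤ (λ i → *-monoˡ-≤-nonNeg (λs i) {{λs≥0′ i}} (bound _ (∈-lookup i))) ⟩
    sum (λ i → λs i * (c · lookup ps i))  ≡⟨ ·-convex-combination λs (lookup ps) x≡′ c ⟨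
    c · x                                 ∎
    where
    open ≤-Reasoning
    x≡′ = λ w → trans (x≡ w) (sumV≡sum (λ i → λs i * lookup ps i w))
    λs≥0′ = λ i → ℚ.nonNegative (λs≥0 i)

  conv-≡ : (∀ p → p ∈ ps → c · p ≡ β) → InConv ps x → c · x ≡ β
  conv-≡ c·p≡β hull = ≤-antisym (conv-≤ (λ p p∈ → ≤-reflexive (c·p≡β p p∈)) hull)
                                (conv-≥ (λ p p∈ → ≤-reflexive (sym (c·p≡β p p∈))) hull)

on-points : ∀ {n} {E : List (Edge n)} (P : Vect n → Set) →
  P zeroV → (∀ e → e ∈ E → P (xE e)) → ∀ p → p ∈ zeroV ∷ map xE E → P p
on-points P P0 Pe p (here refl) = P0
on-points P P0 Pe p (there p∈) with ∈-map⁻ xE p∈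
... | e , e∈E , refl = Pe e e∈E

χ : ∀ {n} → (Fin n → Bool) → Vect n
χ S v = if S v then 1ℚ else 0ℚ

fCut≡χ· : ∀ {n} (S : Fin n → Bool) (x : Vect n) → fCut S x ≡ χ S · x
fCut≡χ· {zero}  S x = refl
fCut≡χ· {suc n} S x with S zero
... | true  = cong₂ _+_ (sym (*-identityˡ (x zero))) (fCut≡χ· (S ∘ suc) (x ∘ suc))
... | false = cong₂ _+_ (sym (*-zeroˡ (x zero))) (fCut≡χ· (S ∘ suc) (x ∘ suc))

directed⇒χ-step-nonNeg : ∀ {n} {E : List (Edge n)} {S : Fin n → Bool} {t h : Fin n} →
  DirectedToV1 E S → (t , h) ∈ E → 0ℚ ≤ χ S h - χ S t
directed⇒χ-step-nonNeg {S = S} {t} {h} directed e∈E with S t | S h | directed (t , h) e∈E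
... | true  | true  | _ = ≤-reflexive (sym (+-inverseʳ 1ℚ))
... | false | false | _ = ≤-refl
... | false | true  | _ = nonNegative⁻¹ 1ℚ
... | true  | false | crossing with crossing (λ ())
...   | () , _

Qtilde⊆RHS : ∀ {n} (E : List (Edge n)) {x : Vect n} → InQtilde E x → InRHS E x
Qtilde⊆RHS {n} E {x} hull = cut-inequality , layering-inequality , sum≡0
  where
  cut-inequality : ∀ S → IsElementaryCut E S → DirectedToV1 E S → 0ℚ ≤ fCut S x
  cut-inequality S _ directed = subst (0ℚ ≤_) (sym (fCut≡χ· S x))
    (conv-≥ (χ S) (on-points {E = E} (λ p → 0ℚ ≤ χ S · p) (≤-reflexive (sym (·-zeroʳ (χ S))))
      (λ { (t , h) e∈E → subst (0ℚ ≤_) (sym (·-xE (χ S) t h)) (directed⇒χ-step-nonNeg directed e∈E) }))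
      hull)

  layering-inequality : ∀ ℓ → IsAdmissibleLayering E ℓ → dotℤ ℓ x ≤ 1ℚ
  layering-inequality ℓ (steps≤1 , _) = subst (_≤ 1ℚ) (sym (sumV≡sum (λ v → ℓℚ v * x v)))
    (conv-≤ ℓℚ (on-points {E = E} (λ p → ℓℚ · p ≤ 1ℚ)
                          (≤-trans (≤-reflexive (·-zeroʳ ℓℚ)) (nonNegative⁻¹ 1ℚ))
      (λ { (t , h) e∈E → subst (_≤ 1ℚ) (sym (trans (·-xE ℓℚ t h) (sym (/1-homo-‿- (ℓ h) (ℓ t)))))
                             (/1-mono-≤ (steps≤1 (t , h) e∈E)) }))
      hull)
    where
    ℓℚ : Vect n
    ℓℚ v = ℓ v / 1

  sum≡0 : sumV x ≡ 0ℚ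
  sum≡0 = trans (sumV≡sum x) (trans (sum-cong-≗ (λ v → sym (*-identityˡ (x v))))
    (conv-≡ 𝟏 (on-points {E = E} (λ p → 𝟏 · p ≡ 0ℚ) (·-zeroʳ 𝟏)
      (λ { (t , h) _ → trans (·-xE 𝟏 t h) (+-inverseʳ 1ℚ) })) hull))
    where
    𝟏 : Vect n
    𝟏 _ = 1ℚ

Constraint : ℕ → Set
Constraint n = Vect n × ℚ

infix 4 _⊨_ _⊢_
infixl 6 _⊕_
infixl 7 _⊛_

_⊨_ : ∀ {n} → Vect n → Constraint n → Set
y ⊨ c = proj₁ c · y ≤ proj₂ c

Feasible : ∀ {n} → List (Constraint n) → Set
Feasible sys = ∃ λ y → ∀ c → c ∈ sys → y ⊨ c

_⊕_ : ∀ {n} → Constraint n → Constraint n → Constraint n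
c ⊕ d = (λ i → proj₁ c i + proj₁ d i) , proj₂ c + proj₂ d

_⊛_ : ∀ {n} → ℚ → Constraint n → Constraint n
q ⊛ c = (λ i → q * proj₁ c i) , q * proj₂ c

data _⊢_ {n} (sys : List (Constraint n)) : Constraint n → Set where
  axiom : ∀ {c} → c ∈ sys → sys ⊢ c
  add   : ∀ {c d} → sys ⊢ c → sys ⊢ d → sys ⊢ c ⊕ d
  scale : ∀ {q c} → 0ℚ ≤ q → sys ⊢ c → sys ⊢ q ⊛ c
  cast  : ∀ {a a′ b b′} → (∀ i → a i ≡ a′ i) → b ≡ b′ → sys ⊢ (a , b) → sys ⊢ (a′ , b′)

Refutable : ∀ {n} → List (Constraint n) → Set
Refutable sys = ∃ λ b → b < 0ℚ × sys ⊢ (zeroV , b)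

module Elimination {n : ℕ} where

  lead : Constraint (suc n) → ℚ
  lead c = proj₁ c zero

  rest : Constraint (suc n) → Constraint n
  rest c = proj₁ c ∘ suc , proj₂ c

  combine : Constraint (suc n) → Constraint (suc n) → Constraint n
  combine p q = rest (- lead q ⊛ p ⊕ lead p ⊛ q)

  module _ (sys : List (Constraint (suc n))) where
    free uppers lowers : List (Constraint (suc n))
    free   = filter (λ c → lead c ≟ 0ℚ) sys
    uppers = filter (λ c → 0ℚ <? lead c) sys
    lowers = filter (λ c → lead c <? 0ℚ) sys

    eliminate : List (Constraint n)
    eliminate = map rest free ++ cartesianProductWith combine uppers lowers

  lift : ∀ {sys c} → eliminate sys ⊢ c → sys ⊢ (0ℚ V.∷ proj₁ c , proj₂ c)
  lift {sys} (axiom c∈) with ∈-++⁻ (map rest (free sys)) c∈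
  ... | inj₁ c∈free with ∈-map⁻ rest c∈free
  ...   | c , c∈ , refl with ∈-filter⁻ (λ c → lead c ≟ 0ℚ) c∈
  ...     | c∈sys , lead≡0 = cast (λ { zero → lead≡0 ; (suc i) → refl }) refl (axiom c∈sys)
  lift {sys} (axiom c∈) | inj₂ c∈combined
    with ∈-cartesianProductWith⁻ combine (uppers sys) (lowers sys) c∈combined
  ... | p , q , p∈ , q∈ , refl
    with ∈-filter⁻ (λ c → 0ℚ <? lead c) p∈ | ∈-filter⁻ (λ c → lead c <? 0ℚ) q∈
  ...   | p∈sys , lead-p>0 | q∈sys , lead-q<0 =
    cast (λ { zero → cancel (lead p) (lead q) ; (suc i) → refl }) refl
      (add (scale (<⇒≤ (neg-antimono-< lead-q<0)) (axiom p∈sys)) (scale (<⇒≤ lead-p>0) (axiom q∈sys)))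
    where
    cancel : ∀ α β → - β * α + α * β ≡ 0ℚ
    cancel = solve 2 (λ α β → :- β :* α :+ α :* β := con 0ℚ) refl
  lift (add d d′)        = cast (λ { zero → +-identityˡ 0ℚ ; (suc i) → refl }) refl (add (lift d) (lift d′))
  lift (scale {q} q≥0 d) = cast (λ { zero → *-zeroʳ q ; (suc i) → refl }) refl (scale q≥0 (lift d))
  lift (cast a≡ b≡ d)    = cast (λ { zero → refl ; (suc i) → a≡ i }) b≡ (lift d)

  residual : Vect n → Constraint (suc n) → ℚ
  residual y′ c = proj₂ c - proj₁ (rest c) · y′

  threshold : Vect n → Constraint (suc n) → ℚ
  threshold y′ c = residual y′ c * recip (lead c)

  ⊨-∷ : ∀ {y₀ y′ c} → lead c * y₀ ≤ residual y′ c → (y₀ V.∷ y′) ⊨ c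
  ⊨-∷ = ≤-‿⇒+≤

  lead*threshold : ∀ y′ c → lead c ≢ 0ℚ → lead c * threshold y′ c ≡ residual y′ c
  lead*threshold y′ c lead≢0 = begin
    lead c * (residual y′ c * recip (lead c))
      ≡⟨ solve 3 (λ α r ι → α :* (r :* ι) := α :* ι :* r) refl (lead c) (residual y′ c) (recip (lead c)) ⟩
    lead c * recip (lead c) * residual y′ c   ≡⟨ cong (_* residual y′ c) (*-recipʳ (lead c) lead≢0) ⟩
    1ℚ * residual y′ c                        ≡⟨ *-identityˡ (residual y′ c) ⟩
    residual y′ c                             ∎
    where open ≡-Reasoning

  threshold-order : ∀ y′ {p q} → 0ℚ < lead p → lead q < 0ℚ → y′ ⊨ combine p q →
                    threshold y′ q ≤ threshold y′ p
  threshold-order y′ {p} {q} lead-p>0 lead-q<0 sat = begin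
    threshold y′ q                    ≡⟨ +-identityʳ (threshold y′ q) ⟨
    threshold y′ q + 0ℚ
      ≤⟨ +-monoʳ-≤ (threshold y′ q) (*-nonNeg (*-nonNeg ιp≥0 -ιq≥0) S≥0) ⟩
    threshold y′ q + ιp * - ιq * S    ≡⟨ cong (threshold y′ q +_) scaled-S ⟩
    threshold y′ q + (threshold y′ p - threshold y′ q)
      ≡⟨ solve 2 (λ u v → u :+ (v :- u) := v) refl (threshold y′ q) (threshold y′ p) ⟩
    threshold y′ p                    ∎
    where
    open ≤-Reasoning
    α = lead p
    β = lead q
    ιp = recip α
    ιq = recip β
    ap = proj₁ (rest p)
    aq = proj₁ (rest q)
    S = - β * proj₂ p + α * proj₂ q - (- β * (ap · y′) + α * (aq · y′))

    ιp≥0 : 0ℚ ≤ ιp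
    ιp≥0 = <⇒≤ (recip-pos lead-p>0)

    -ιq≥0 : 0ℚ ≤ - ιq
    -ιq≥0 = <⇒≤ (neg-antimono-< (recip-neg lead-q<0))

    S≥0 : 0ℚ ≤ S
    S≥0 = p≤q⇒0≤q-p (subst (_≤ proj₂ (combine p q)) combined≡ sat)
      where
      combined≡ : proj₁ (combine p q) · y′ ≡ - β * (ap · y′) + α * (aq · y′)
      combined≡ = trans (·-distribʳ-+ (λ i → - β * ap i) (λ i → α * aq i) y′)
                        (cong₂ _+_ (·-scaleˡ (- β) ap y′) (·-scaleˡ α aq y′))

    scaled-S : ιp * - ιq * S ≡ threshold y′ p - threshold y′ q
    scaled-S = begin-equality
      ιp * - ιq * S
        ≡⟨ solve 8 (λ ιp ιq α β bp bq dp dq →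
                      ιp :* (:- ιq) :* ((:- β) :* bp :+ α :* bq :- ((:- β) :* dp :+ α :* dq))
                      := β :* ιq :* ((bp :- dp) :* ιp) :- α :* ιp :* ((bq :- dq) :* ιq))
                   refl ιp ιq α β (proj₂ p) (proj₂ q) (ap · y′) (aq · y′) ⟩
      β * ιq * threshold y′ p - α * ιp * threshold y′ q
        ≡⟨ cong₂ (λ u v → u * threshold y′ p - v * threshold y′ q)
                 (*-recipʳ β (<⇒≢ lead-q<0)) (*-recipʳ α (≢-sym (<⇒≢ lead-p>0))) ⟩
      1ℚ * threshold y′ p - 1ℚ * threshold y′ q
        ≡⟨ cong₂ _-_ (*-identityˡ (threshold y′ p)) (*-identityˡ (threshold y′ q)) ⟩
      threshold y′ p - threshold y′ q ∎

  extend : ∀ sys y′ → (∀ c → c ∈ eliminate sys → y′ ⊨ c) →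
           ∃ λ y₀ → ∀ c → c ∈ sys → (y₀ V.∷ y′) ⊨ c
  extend sys y′ sat = y₀ , λ c c∈ → ⊨-∷ {c = c} (bound c c∈)
    where
    open ≤-Reasoning
    y₀ : ℚ
    y₀ = max (min 0ℚ (map (threshold y′) (uppers sys))) (map (threshold y′) (lowers sys))

    below-uppers : ∀ {p} → p ∈ uppers sys → y₀ ≤ threshold y′ p
    below-uppers {p} p∈ = max≤v⁺
      (min≤v⁺ 0ℚ (map (threshold y′) (uppers sys)) (inj₂ (lose (∈-map⁺ (threshold y′) p∈) ≤-refl)))
      (map⁺ (All.tabulate λ {q} q∈ →
        threshold-order y′ {p} {q} (proj₂ (∈-filter⁻ (λ c → 0ℚ <? lead c) {xs = sys} p∈))
                                   (proj₂ (∈-filter⁻ (λ c → lead c <? 0ℚ) {xs = sys} q∈))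
          (sat (combine p q) (∈-++⁺ʳ (map rest (free sys)) (∈-cartesianProductWith⁺ combine p∈ q∈)))))

    above-lowers : ∀ {q} → q ∈ lowers sys → threshold y′ q ≤ y₀
    above-lowers q∈ =
      v≤max⁺ _ (map (threshold y′) (lowers sys)) (inj₂ (lose (∈-map⁺ (threshold y′) q∈) ≤-refl))

    bound : ∀ c → c ∈ sys → lead c * y₀ ≤ residual y′ c
    bound c c∈ with <-cmp (lead c) 0ℚ
    ... | tri≈ _ lead≡0 _ = begin
      lead c * y₀    ≡⟨ cong (_* y₀) lead≡0 ⟩
      0ℚ * y₀        ≡⟨ *-zeroˡ y₀ ⟩
      0ℚ             ≤⟨ p≤q⇒0≤q-p (sat (rest c) rest∈) ⟩
      residual y′ c  ∎
      where
      rest∈ : rest c ∈ eliminate sys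
      rest∈ = ∈-++⁺ˡ (∈-map⁺ rest (∈-filter⁺ (λ c → lead c ≟ 0ℚ) c∈ lead≡0))
    ... | tri> _ _ lead>0 = begin
      lead c * y₀              ≤⟨ *-monoˡ-≤-nonNeg (lead c) {{ℚ.nonNegative (<⇒≤ lead>0)}}
                                    (below-uppers (∈-filter⁺ (λ c → 0ℚ <? lead c) c∈ lead>0)) ⟩
      lead c * threshold y′ c  ≡⟨ lead*threshold y′ c (≢-sym (<⇒≢ lead>0)) ⟩
      residual y′ c            ∎
    ... | tri< lead<0 _ _ = begin
      lead c * y₀              ≤⟨ *-monoˡ-≤-nonPos (lead c) {{ℚ.nonPositive (<⇒≤ lead<0)}}
                                    (above-lowers (∈-filter⁺ (λ c → lead c <? 0ℚ) c∈ lead<0)) ⟩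
      lead c * threshold y′ c  ≡⟨ lead*threshold y′ c (<⇒≢ lead<0) ⟩
      residual y′ c            ∎

fourier-motzkin : ∀ {n} (sys : List (Constraint n)) → Feasible sys ⊎ Refutable sys
fourier-motzkin {zero} sys with any? (λ c → proj₂ c <? 0ℚ) sys
... | yes violated = let c , c∈ , b<0 = find violated in inj₂ (proj₂ c , b<0 , cast (λ ()) refl (axiom c∈))
... | no satisfied = inj₁ ((λ ()) , λ c c∈ → ≮⇒≥ (satisfied ∘ lose c∈))
fourier-motzkin {suc n} sys with fourier-motzkin (Elimination.eliminate sys)
... | inj₁ (y′ , sat) = let y₀ , sat′ = Elimination.extend sys y′ sat in inj₁ (y₀ V.∷ y′ , sat′)
... | inj₂ (b , b<0 , d) =
  inj₂ (b , b<0 , cast (λ { zero → refl ; (suc i) → refl }) refl (Elimination.lift d))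

NonNegCombination : ∀ {n k} → (Fin k → Constraint n) → Constraint n → Set
NonNegCombination {k = k} sys c = Σ (Fin k → ℚ) λ μ → (∀ i → 0ℚ ≤ μ i) ×
  (∀ w → proj₁ c w ≡ μ · (λ i → proj₁ (sys i) w)) × (proj₂ c ≡ μ · (proj₂ ∘ sys))

derivable⇒nonNegCombination : ∀ {n k} (sys : Fin k → Constraint n) {c} →
  tabulate sys ⊢ c → NonNegCombination sys c
derivable⇒nonNegCombination sys (axiom c∈) with ∈-tabulate⁻ c∈
... | i , refl =
  ind i , ind-nonNeg i , (λ w → sym (∑-ind i (λ j → proj₁ (sys j) w))) , sym (∑-ind i (proj₂ ∘ sys))
derivable⇒nonNegCombination sys (add d d′)
  with derivable⇒nonNegCombination sys d | derivable⇒nonNegCombination sys d′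
... | μ , μ≥0 , a≡ , b≡ | ν , ν≥0 , a′≡ , b′≡ =
  (λ i → μ i + ν i) , (λ i → +-mono-≤ (μ≥0 i) (ν≥0 i)) ,
  (λ w → trans (cong₂ _+_ (a≡ w) (a′≡ w)) (sym (·-distribʳ-+ μ ν (λ i → proj₁ (sys i) w)))) ,
  trans (cong₂ _+_ b≡ b′≡) (sym (·-distribʳ-+ μ ν (proj₂ ∘ sys)))
derivable⇒nonNegCombination sys (scale {q} q≥0 d) with derivable⇒nonNegCombination sys d
... | μ , μ≥0 , a≡ , b≡ =
  (λ i → q * μ i) , (λ i → *-nonNeg q≥0 (μ≥0 i)) ,
  (λ w → trans (cong (q *_) (a≡ w)) (sym (·-scaleˡ q μ (λ i → proj₁ (sys i) w)))) ,
  trans (cong (q *_) b≡) (sym (·-scaleˡ q μ (proj₂ ∘ sys)))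
derivable⇒nonNegCombination sys (cast a≡a′ b≡b′ d) with derivable⇒nonNegCombination sys d
... | μ , μ≥0 , a≡ , b≡ = μ , μ≥0 , (λ w → trans (sym (a≡a′ w)) (a≡ w)) , trans (sym b≡b′) b≡

farkas : ∀ {n k} (sys : Fin k → Constraint n) →
  (∃ λ y → ∀ i → y ⊨ sys i) ⊎
  (Σ (Fin k → ℚ) λ μ → (∀ i → 0ℚ ≤ μ i) × (∀ w → μ · (λ i → proj₁ (sys i) w) ≡ 0ℚ) ×
                       μ · (proj₂ ∘ sys) < 0ℚ)
farkas sys with fourier-motzkin (tabulate sys)
... | inj₁ (y , sat) = inj₁ (y , λ i → sat (sys i) (∈-tabulate⁺ i))
... | inj₂ (b , b<0 , d) with derivable⇒nonNegCombination sys d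
...   | μ , μ≥0 , 0≡ , b≡ = inj₂ (μ , μ≥0 , (λ w → sym (0≡ w)) , subst (_< 0ℚ) b≡ b<0)

IsRationalLayering : ∀ {n} → List (Edge n) → Vect n → Set
IsRationalLayering E m = ∀ e → e ∈ E → m (head e) - m (tail e) ≤ 1ℚ

SeparatingLayering : ∀ {n} → List (Edge n) → Vect n → Set
SeparatingLayering {n} E x = Σ (Vect n) λ m → IsRationalLayering E m × 1ℚ < m · x

module Separation {n : ℕ} (E : List (Edge n)) (x : Vect n) where

  points : List (Vect n)
  points = zeroV ∷ map xE E

  -- Unknowns (s , m): the first constraint reads s + 1 ≤ m · x, the others m · p ≤ s for p ∈ points.
  system : Fin (suc (length points)) → Constraint (suc n)
  system = ((1ℚ V.∷ (-_ ∘ x)) , - 1ℚ) V.∷ λ i → (- 1ℚ V.∷ lookup points i) , 0ℚ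

  -- s ≥ 0 since 0 ∈ points, so k = 1/(s + ½) > 0 rescales m · p ≤ s to ≤ 1 and s + 1 ≤ m · x to > 1.
  layering-of-solution : ∀ y → (∀ i → y ⊨ system i) → SeparatingLayering E x
  layering-of-solution y sat = (λ v → k * m v) , steps≤1 , separates
    where
    s = y zero
    m = y ∘ suc
    k = recip (s + ½)

    below : ∀ {p} → p ∈ points → p · m ≤ s
    below {p} p∈ = begin
      p · m                               ≡⟨ cong (_· m) (lookup-index p∈) ⟩
      lookup points i · m
        ≡⟨ solve 2 (λ s d → d := con (- 1ℚ) :* s :+ d :+ s) refl s (lookup points i · m) ⟩
      - 1ℚ * s + lookup points i · m + s  ≤⟨ +-monoˡ-≤ s (sat (suc i)) ⟩
      0ℚ + s                              ≡⟨ +-identityˡ s ⟩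
      s                                   ∎
      where
      open ≤-Reasoning
      i = index p∈

    above : s + 1ℚ ≤ m · x
    above = begin
      s + 1ℚ
        ≡⟨ solve 2 (λ s d → s :+ con 1ℚ := d :- (con (- 1ℚ) :- (con 1ℚ :* s :+ :- d))) refl s (m · x) ⟩
      m · x - (- 1ℚ - (1ℚ * s + - (m · x)))
        ≤⟨ +-monoʳ-≤ (m · x) (neg-antimono-≤ (p≤q⇒0≤q-p constraint)) ⟩
      m · x - 0ℚ                             ≡⟨ +-identityʳ (m · x) ⟩
      m · x                                  ∎
      where
      open ≤-Reasoning
      -x·m≡-m·x : (-_ ∘ x) · m ≡ - (m · x)
      -x·m≡-m·x = trans (sum-cong-≗ (λ v → sym (neg-distribˡ-* (x v) (m v))))
                        (trans (∑-neg (λ v → x v * m v)) (cong -_ (·-comm x m)))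
      constraint : 1ℚ * s + - (m · x) ≤ - 1ℚ
      constraint = subst (λ d → 1ℚ * s + d ≤ - 1ℚ) -x·m≡-m·x (sat zero)

    0<½ : 0ℚ < ½
    0<½ = ℚ.*<* (ℤ.+<+ (s≤s z≤n))

    s+½>0 : 0ℚ < s + ½
    s+½>0 = +-mono-≤-< (subst (_≤ s) (trans (·-comm zeroV m) (·-zeroʳ m)) (below (here refl))) 0<½

    k≥0 : 0ℚ ≤ k
    k≥0 = <⇒≤ (recip-pos s+½>0)

    k[s+½]≡1 : k * (s + ½) ≡ 1ℚ
    k[s+½]≡1 = trans (*-comm k (s + ½)) (*-recipʳ (s + ½) (≢-sym (<⇒≢ s+½>0)))

    steps≤1 : IsRationalLayering E (λ v → k * m v)
    steps≤1 (t , h) e∈ = begin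
      k * m h - k * m t  ≡⟨ solve 3 (λ k a b → k :* a :- k :* b := k :* (a :- b)) refl k (m h) (m t) ⟩
      k * (m h - m t)    ≤⟨ *-monoˡ-≤-nonNeg k {{ℚ.nonNegative k≥0}} step≤s ⟩
      k * s              ≤⟨ *-monoˡ-≤-nonNeg k {{ℚ.nonNegative k≥0}} s≤s+½ ⟩
      k * (s + ½)        ≡⟨ k[s+½]≡1 ⟩
      1ℚ                 ∎
      where
      open ≤-Reasoning
      step≤s : m h - m t ≤ s
      step≤s = subst (_≤ s) (trans (·-comm (xE (t , h)) m) (·-xE m t h)) (below (there (∈-map⁺ xE e∈)))
      s≤s+½ : s ≤ s + ½
      s≤s+½ = subst (_≤ s + ½) (+-identityʳ s) (+-monoʳ-≤ s (<⇒≤ 0<½))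

    separates : 1ℚ < (λ v → k * m v) · x
    separates = begin-strict
      1ℚ                   ≡⟨ k[s+½]≡1 ⟨
      k * (s + ½)          <⟨ *-monoʳ-<-pos k {{ℚ.positive (recip-pos s+½>0)}} (+-monoʳ-< s ½<1) ⟩
      k * (s + 1ℚ)         ≤⟨ *-monoˡ-≤-nonNeg k {{ℚ.nonNegative k≥0}} above ⟩
      k * (m · x)          ≡⟨ ·-scaleˡ k m x ⟨
      (λ v → k * m v) · x  ∎
      where
      open ≤-Reasoning
      ½<1 : ½ < 1ℚ
      ½<1 = ℚ.*<* (ℤ.+<+ (s≤s (s≤s z≤n)))

  -- Coordinate s of the certificate gives ∑ ν = κ, coordinate w gives ∑ ν_p p_w = κ x_w, and the
  -- right-hand side gives κ > 0; so the weights ν / κ exhibit x as a convex combination.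
  hull-of-certificate : (μ : Fin (suc (length points)) → ℚ) → (∀ i → 0ℚ ≤ μ i) →
    (∀ w → μ · (λ i → proj₁ (system i) w) ≡ 0ℚ) → μ · (proj₂ ∘ system) < 0ℚ → InQtilde E x
  hull-of-certificate μ μ≥0 balanced negative = λs , λs≥0 , ∑λs≡1 , x≡
    where
    κ = μ zero
    ν = μ ∘ suc
    ι = recip κ

    κ>0 : 0ℚ < κ
    κ>0 = subst (0ℚ <_) (neg-involutive κ) (neg-antimono-< (subst (_< 0ℚ) -κ≡ negative))
      where
      -κ≡ : κ * - 1ℚ + ν · zeroV ≡ - κ
      -κ≡ = trans (cong (κ * - 1ℚ +_) (·-zeroʳ ν))
                  (solve 1 (λ κ → κ :* con (- 1ℚ) :+ con 0ℚ := :- κ) refl κ)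

    ∑ν≡κ : sum ν ≡ κ
    ∑ν≡κ = trans (neg-injective (trans (sym ν·-1≡-∑ν) (inverseʳ-unique (κ * 1ℚ) _ (balanced zero))))
                 (*-identityʳ κ)
      where
      ν·-1≡-∑ν : ν · (λ _ → - 1ℚ) ≡ - sum ν
      ν·-1≡-∑ν = trans (sum-cong-≗ (λ i → trans (sym (neg-distribʳ-* (ν i) 1ℚ))
                                                (cong -_ (*-identityʳ (ν i)))))
                       (∑-neg ν)

    ν·p≡κx : ∀ w → ν · (λ i → lookup points i w) ≡ κ * x w
    ν·p≡κx w = trans (inverseʳ-unique (κ * - x w) _ (balanced (suc w)))
                     (trans (neg-distribʳ-* κ (- x w)) (cong (κ *_) (neg-involutive (x w))))

    κι≡1 : κ * ι ≡ 1ℚ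
    κι≡1 = *-recipʳ κ (≢-sym (<⇒≢ κ>0))

    λs : Fin (length points) → ℚ
    λs i = ν i * ι

    λs≥0 : ∀ i → 0ℚ ≤ λs i
    λs≥0 i = *-nonNeg (μ≥0 (suc i)) (<⇒≤ (recip-pos κ>0))

    ∑λs≡1 : sumV λs ≡ 1ℚ
    ∑λs≡1 = trans (sumV≡sum λs) (trans (sym (*-distribʳ-sum ι ν)) (trans (cong (_* ι) ∑ν≡κ) κι≡1))

    x≡ : ∀ w → x w ≡ sumV (λ i → λs i * lookup points i w)
    x≡ w = sym (begin
      sumV (λ i → ν i * ι * lookup points i w)   ≡⟨ sumV≡sum (λ i → ν i * ι * lookup points i w) ⟩
      sum (λ i → ν i * ι * lookup points i w)    ≡⟨ sum-cong-≗ (λ i → reorder (ν i) ι (lookup points i w)) ⟩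
      sum (λ i → ι * (ν i * lookup points i w))  ≡⟨ *-distribˡ-sum ι (λ i → ν i * lookup points i w) ⟨
      ι * (ν · (λ i → lookup points i w))        ≡⟨ cong (ι *_) (ν·p≡κx w) ⟩
      ι * (κ * x w)                              ≡⟨ solve 3 (λ ι κ x → ι :* (κ :* x) := κ :* ι :* x)
                                                           refl ι κ (x w) ⟩
      κ * ι * x w                                ≡⟨ cong (_* x w) κι≡1 ⟩
      1ℚ * x w                                   ≡⟨ *-identityˡ (x w) ⟩
      x w                                        ∎)
      where
      open ≡-Reasoning
      reorder : ∀ a b c → a * b * c ≡ b * (a * c)
      reorder = solve 3 (λ a b c → a :* b :* c := b :* (a :* c)) refl

separation : ∀ {n} (E : List (Edge n)) (x : Vect n) → InQtilde E x ⊎ SeparatingLayering E x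
separation E x with farkas (Separation.system E x)
... | inj₁ (y , sat) = inj₂ (Separation.layering-of-solution E x y sat)
... | inj₂ (μ , μ≥0 , balanced , negative) = inj₁ (Separation.hull-of-certificate E x μ μ≥0 balanced negative)

true≢false : true ≢ false
true≢false ()

module _ {n : ℕ} {E : List (Edge n)} where

  WConn-trans : ∀ {P u v w} → WConn E P u v → WConn E P v w → WConn E P u w
  WConn-trans here            q = q
  WConn-trans (fwd e∈ p rest) q = fwd e∈ p (WConn-trans rest q)
  WConn-trans (bwd e∈ p rest) q = bwd e∈ p (WConn-trans rest q)

  WConn-sym : ∀ {P u v} → WConn E P u v → WConn E P v u
  WConn-sym here            = here
  WConn-sym (fwd e∈ p rest) = WConn-trans (WConn-sym rest) (bwd e∈ p here)
  WConn-sym (bwd e∈ p rest) = WConn-trans (WConn-sym rest) (fwd e∈ p here)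

  WConn-map : ∀ {P Q : Edge n → Set} → (∀ {e} → e ∈ E → P e → Q e) →
              ∀ {u v} → WConn E P u v → WConn E Q u v
  WConn-map P⇒Q here            = here
  WConn-map P⇒Q (fwd e∈ p rest) = fwd e∈ (P⇒Q e∈ p) (WConn-map P⇒Q rest)
  WConn-map P⇒Q (bwd e∈ p rest) = bwd e∈ (P⇒Q e∈ p) (WConn-map P⇒Q rest)

  Closed : (Edge n → Set) → (Fin n → Bool) → Set
  Closed P K = ∀ {t h} → (t , h) ∈ E → P (t , h) → K t ≡ K h

  constant-along : ∀ {P K} → Closed P K → ∀ {u v} → WConn E P u v → K u ≡ K v
  constant-along closed here            = refl
  constant-along closed (fwd e∈ p rest) = trans (closed e∈ p) (constant-along closed rest)
  constant-along closed (bwd e∈ p rest) = trans (sym (closed e∈ p)) (constant-along closed rest)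

  closed-of-no-crossing : ∀ {P} (K : Fin n → Bool) → ¬ Any (λ e → P e × Crosses K e) E → Closed P K
  closed-of-no-crossing K none {t} {h} e∈ p =
    decidable-stable (K t ≟ᵇ K h) (λ cross → none (lose e∈ (p , cross)))

  crossing-edge : ∀ {P} (S : Fin n → Bool) {u v} → S u ≢ S v → WConn E P u v → Any (Crosses S) E
  crossing-edge {P} S Su≢Sv path with any? (λ { (t , h) → ¬? (S t ≟ᵇ S h) }) E
  ... | yes crossing = crossing
  ... | no none = ⊥-elim (Su≢Sv (constant-along (closed-of-no-crossing {P} S (none ∘ Any.map proj₂)) path))

  record Component (P : Edge n → Set) (r : Fin n) : Set where
    field
      members : Fin n → Bool
      root    : members r ≡ true
      reach   : ∀ {u} → members u ≡ true → WConn E P u r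
      closed  : Closed P members

infix 4 _⊆_ _⊃_

_⊆_ : ∀ {n} → (Fin n → Bool) → (Fin n → Bool) → Set
K ⊆ K′ = ∀ v → K v ≡ true → K′ v ≡ true

_⊃_ : ∀ {n} → (Fin n → Bool) → (Fin n → Bool) → Set
K′ ⊃ K = K ⊆ K′ × ∃ λ v → K v ≡ false × K′ v ≡ true

⊃-wellFounded : ∀ {n} → WellFounded (_⊃_ {n})
⊃-wellFounded {n} =
  Subrelation.wellFounded shrinks (On.wellFounded (λ K → n ∸ ∣ Vec.tabulate K ∣) <-wellFounded)
  where
  ∈-Vec-tabulate : ∀ {K : Fin n → Bool} {v} → K v ≡ true → Vec.tabulate K Vec.[ v ]= true
  ∈-Vec-tabulate {K} {v} Kv = lookup⇒[]= v (Vec.tabulate K) (trans (lookup∘tabulate K v) Kv)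

  ∈-Vec-tabulate⁻ : ∀ {K : Fin n → Bool} {v} → Vec.tabulate K Vec.[ v ]= true → K v ≡ true
  ∈-Vec-tabulate⁻ {K} {v} v∈ = trans (sym (lookup∘tabulate K v)) ([]=⇒lookup v∈)

  shrinks : ∀ {K′ K} → K′ ⊃ K → n ∸ ∣ Vec.tabulate K′ ∣ ℕ.< n ∸ ∣ Vec.tabulate K ∣
  shrinks {K′} (K⊆K′ , v , Kv , K′v) = ℕₚ.∸-monoʳ-<
    (p⊂q⇒∣p∣<∣q∣ ((λ {u} u∈ → ∈-Vec-tabulate (K⊆K′ u (∈-Vec-tabulate⁻ u∈))) ,
                  v , ∈-Vec-tabulate K′v , λ v∈ → true≢false (trans (sym (∈-Vec-tabulate⁻ v∈)) Kv)))
    (∣p∣≤n (Vec.tabulate K′))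

insert : ∀ {n} → (Fin n → Bool) → Fin n → Fin n → Bool
insert K c v with v Fin.≟ c
... | yes _ = true
... | no _  = K v

insert-self : ∀ {n} (K : Fin n → Bool) c → insert K c c ≡ true
insert-self K c with c Fin.≟ c
... | yes _  = refl
... | no c≢c = ⊥-elim (c≢c refl)

insert-⊃ : ∀ {n} {K : Fin n → Bool} {c} → K c ≡ false → insert K c ⊃ K
insert-⊃ {K = K} {c} Kc = old , c , Kc , insert-self K c
  where
  old : K ⊆ insert K c
  old v Kv with v Fin.≟ c
  ... | yes _ = refl
  ... | no _  = Kv

insert⁻ : ∀ {n} (K : Fin n → Bool) c v → insert K c v ≡ true → v ≡ c ⊎ K v ≡ true
insert⁻ K c v in-insert with v Fin.≟ c
... | yes v≡c = inj₁ v≡c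
... | no _    = inj₂ in-insert

module _ {n : ℕ} {E : List (Edge n)} {P : Edge n → Set} (P? : ∀ e → Dec (P e)) (r : Fin n) where

  -- Opaque: clients only use the fields, and unfolding the well-founded recursion is very costly.
  opaque
    component : Component {E = E} P r
    component = grow (insert (λ _ → false) r) (insert-self _ r) reach₀ (⊃-wellFounded _)
      where
      reach₀ : ∀ {u} → insert (λ _ → false) r u ≡ true → WConn E P u r
      reach₀ {u} in-singleton with insert⁻ (λ _ → false) r u in-singleton
      ... | inj₁ refl = here
      ... | inj₂ ()

      grow : (K : Fin n → Bool) → K r ≡ true → (∀ {u} → K u ≡ true → WConn E P u r) →
             Acc _⊃_ K → Component {E = E} P r
      grow K root reach (acc larger) with any? (λ { (t , h) → P? (t , h) ×-dec ¬? (K t ≟ᵇ K h) }) E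
      ... | no none = record { members = K ; root = root ; reach = reach ; closed = closed-of-no-crossing K none }
      ... | yes crossing with find crossing
      ...   | (t , h) , e∈ , p , K-crossed with K t in Kt | K h in Kh
      ...     | true  | true  = ⊥-elim (K-crossed refl)
      ...     | false | false = ⊥-elim (K-crossed refl)
      ...     | true  | false = grow (insert K h) (proj₁ (insert-⊃ Kh) r root) reach′ (larger (insert-⊃ Kh))
        where
        reach′ : ∀ {u} → insert K h u ≡ true → WConn E P u r
        reach′ {u} in-K′ with insert⁻ K h u in-K′
        ... | inj₁ refl = bwd e∈ p (reach Kt)
        ... | inj₂ Ku   = reach Ku
      ...     | false | true  = grow (insert K t) (proj₁ (insert-⊃ Kt) r root) reach′ (larger (insert-⊃ Kt))
        where
        reach′ : ∀ {u} → insert K t u ≡ true → WConn E P u r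
        reach′ {u} in-K′ with insert⁻ K t u in-K′
        ... | inj₁ refl = fwd e∈ p (reach Kh)
        ... | inj₂ Ku   = reach Ku

crosses-not : ∀ {n} {S : Fin n → Bool} e → Crosses S e → Crosses (not ∘ S) e
crosses-not (t , h) cross = cross ∘ not-injective

crosses-not⁻ : ∀ {n} {S : Fin n → Bool} e → Crosses (not ∘ S) e → Crosses S e
crosses-not⁻ (t , h) cross = cross ∘ cong not

module _ {n : ℕ} {E : List (Edge n)} where

  ShoresConnected : (Fin n → Bool) → Set
  ShoresConnected S = ∀ {u v} → S u ≡ S v → WConn E (¬_ ∘ Crosses S) u v

  shoresConnected⇒elementary : ∀ {S} → ShoresConnected S → IsCut E S → IsElementaryCut E S
  shoresConnected⇒elementary {S} shores cut = cut , minimal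
    where
    minimal : ∀ S′ → IsCut E S′ → CutSubset E S′ S → CutSubset E S S′
    minimal S′ cut′ S′⊆S (t , h) _ St≢Sh S′t≡S′h = no-crossing cut′
      where
      S′-along : ∀ {u v} → S u ≡ S v → S′ u ≡ S′ v
      S′-along Su≡Sv = constant-along
        (λ {a} {b} e∈ uncut → decidable-stable (S′ a ≟ᵇ S′ b) (uncut ∘ S′⊆S (a , b) e∈))
        (shores Su≡Sv)

      S′-constant : ∀ w → S′ w ≡ S′ t
      S′-constant w with S w ≟ᵇ S t
      ... | yes Sw≡St = S′-along Sw≡St
      ... | no Sw≢St  = trans (S′-along Sw≡Sh) (sym S′t≡S′h)
        where
        Sw≡Sh : S w ≡ S h
        Sw≡Sh = trans (¬-not Sw≢St) (trans (cong not (¬-not St≢Sh)) (not-involutive (S h)))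

      no-crossing : ¬ Any (Crosses S′) E
      no-crossing crossing with find crossing
      ... | (a , b) , _ , S′a≢S′b = S′a≢S′b (trans (S′-constant a) (sym (S′-constant b)))

  elementary-not : ∀ {S} → IsElementaryCut E S → IsElementaryCut E (not ∘ S)
  elementary-not {S} (cut , minimal) = Any.map (λ {e} → crosses-not {S = S} e) cut , minimal′
    where
    minimal′ : ∀ S′ → IsCut E S′ → CutSubset E S′ (not ∘ S) → CutSubset E (not ∘ S) S′
    minimal′ S′ cut′ S′⊆S̄ e e∈ =
      minimal S′ cut′ (λ e e∈ → crosses-not⁻ {S = S} e ∘ S′⊆S̄ e e∈) e e∈ ∘ crosses-not⁻ {S = S} e

module OutsideComponent {n : ℕ} {E : List (Edge n)} (connected : Connected E) {P : Edge n → Set}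
                        {r : Fin n} (K : Component {E = E} P r)
                        {v : Fin n} (Kv : Component.members K v ≡ false) where
  open Component K

  Outside : Edge n → Set
  Outside e = members (tail e) ≡ false × members (head e) ≡ false

  outside? : ∀ e → Dec (Outside e)
  outside? (t , h) = (members t ≟ᵇ false) ×-dec (members h ≟ᵇ false)

  module C = Component (component {E = E} outside? v)
  C = C.members

  K-false-in-C : ∀ {u} → C u ≡ true → members u ≡ false
  K-false-in-C Cu = trans (constant-along (λ _ (Kt , Kh) → trans Kt (sym Kh)) (C.reach Cu)) Kv

  C-false-in-K : ∀ {u} → members u ≡ true → C u ≡ false
  C-false-in-K {u} Ku with C u in Cu
  ... | true  = ⊥-elim (true≢false (trans (sym Ku) (K-false-in-C Cu)))
  ... | false = refl

  C-cut⊆K-cut : CutSubset E C members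
  C-cut⊆K-cut (t , h) e∈ Ct≢Ch Kt≡Kh with members t in Kt
  ... | true  = Ct≢Ch (trans (C-false-in-K Kt) (sym (C-false-in-K (sym Kt≡Kh))))
  ... | false = Ct≢Ch (C.closed e∈ (Kt , sym Kt≡Kh))

  C-false-next : ∀ {u w} → members u ≡ false → C u ≡ false →
                 (members w ≡ false → C u ≡ C w) → C w ≡ false
  C-false-next {w = w} Ku Cu same with members w in Kw
  ... | true  = C-false-in-K Kw
  ... | false = trans (sym (same refl)) Cu

  inside : ∀ {u} → C u ≡ true → WConn E (¬_ ∘ Crosses C) u v
  inside Cu = WConn-map (λ e∈ outside cross → cross (C.closed e∈ outside)) (C.reach Cu)

  -- Follow the path until it first enters K; from there the P-path of K leads to r, and P-edges
  -- do not cross K, hence do not cross C.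
  escape : ∀ {u} → C u ≡ false → WConn E (λ _ → ⊤') u r → WConn E (¬_ ∘ Crosses C) u r
  escape Cu here = here
  escape {u} Cu (fwd {h = h} e∈ _ rest) with members u in Ku
  ... | true  = WConn-map (λ e∈ p cross → C-cut⊆K-cut _ e∈ cross (closed e∈ p)) (reach Ku)
  ... | false = fwd e∈ (λ cross → cross (trans Cu (sym Ch))) (escape Ch rest)
    where
    Ch : C h ≡ false
    Ch = C-false-next Ku Cu (λ Kh → C.closed e∈ (Ku , Kh))
  escape {u} Cu (bwd {t = t} e∈ _ rest) with members u in Ku
  ... | true  = WConn-map (λ e∈ p cross → C-cut⊆K-cut _ e∈ cross (closed e∈ p)) (reach Ku)
  ... | false = bwd e∈ (λ cross → cross (trans Ct (sym Cu))) (escape Ct rest)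
    where
    Ct : C t ≡ false
    Ct = C-false-next Ku Cu (λ Kt → sym (C.closed e∈ (Kt , Ku)))

  shores : ShoresConnected {E = E} C
  shores {u} {w} Cu≡Cw with C u in Cu
  ... | true  = WConn-trans (inside Cu) (WConn-sym (inside (sym Cu≡Cw)))
  ... | false = WConn-trans (escape Cu (connected u r)) (WConn-sym (escape (sym Cu≡Cw) (connected w r)))

  C-cut : IsCut E C
  C-cut = crossing-edge C (λ Cv≡Cr → true≢false (trans (sym C.root) (trans Cv≡Cr (C-false-in-K root))))
                          (connected v r)

  C-elementary : IsElementaryCut E C
  C-elementary = shoresConnected⇒elementary shores C-cut

Tightℚ : ∀ {n} → Vect n → Edge n → Set
Tightℚ m e = m (head e) - m (tail e) ≡ 1ℚ

tight? : ∀ {n} (m : Vect n) e → Dec (Tightℚ m e)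
tight? m (t , h) = (m h - m t) ≟ 1ℚ

Enters : ∀ {n} → (Fin n → Bool) → Edge n → Set
Enters U e = U (tail e) ≡ false × U (head e) ≡ true

enters? : ∀ {n} (U : Fin n → Bool) e → Dec (Enters U e)
enters? U (t , h) = (U t ≟ᵇ false) ×-dec (U h ≟ᵇ true)

enters⇒crosses : ∀ {n} {U : Fin n → Bool} e → Enters U e → Crosses U e
enters⇒crosses (t , h) (Ut , Uh) Ut≡Uh = true≢false (trans (sym Uh) (trans (sym Ut≡Uh) Ut))

fCut-not : ∀ {n} (U : Fin n → Bool) (x : Vect n) → sumV x ≡ 0ℚ → fCut (not ∘ U) x ≡ - fCut U x
fCut-not U x ∑x≡0 = inverseʳ-unique (fCut U x) (fCut (not ∘ U) x) (begin
  fCut U x + fCut (not ∘ U) x        ≡⟨ cong₂ _+_ (fCut≡χ· U x) (fCut≡χ· (not ∘ U) x) ⟩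
  χ U · x + χ (not ∘ U) · x          ≡⟨ ·-distribʳ-+ (χ U) (χ (not ∘ U)) x ⟨
  (λ v → χ U v + χ (not ∘ U) v) · x
    ≡⟨ sum-cong-≗ (λ v → trans (cong (_* x v) (χ+χ-not (U v))) (*-identityˡ (x v))) ⟩
  sum x                              ≡⟨ trans (sym (sumV≡sum x)) ∑x≡0 ⟩
  0ℚ                                 ∎)
  where
  open ≡-Reasoning
  χ+χ-not : ∀ b → (if b then 1ℚ else 0ℚ) + (if not b then 1ℚ else 0ℚ) ≡ 1ℚ
  χ+χ-not true  = refl
  χ+χ-not false = refl

module Shift {n : ℕ} {E : List (Edge n)} {m : Vect n} (layering : IsRationalLayering E m)
             (U : Fin n → Bool) (entering : Any (Enters U) E) where

  slack : Edge n → ℚ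
  slack e = 1ℚ - (m (head e) - m (tail e))

  candidates : List (Edge n)
  candidates = filter (enters? U) E

  e* : Edge n
  e* = argmin slack (proj₁ (find entering)) candidates

  e*∈E×enters : e* ∈ E × Enters U e*
  e*∈E×enters = [ (λ e*≡e₀ → subst (λ e → e ∈ E × Enters U e) (sym e*≡e₀) (proj₂ (find entering)))
                , ∈-filter⁻ (enters? U) {xs = E}
                ]′ (argmin-sel slack (proj₁ (find entering)) candidates)

  slack-minimal : ∀ {e} → e ∈ E → Enters U e → slack e* ≤ slack e
  slack-minimal e∈ enters =
    All.lookup (f[argmin]≤f[xs] {f = slack} (proj₁ (find entering)) candidates)
               (∈-filter⁺ (enters? U) e∈ enters)

  δ : ℚ
  δ = slack e*

  δ≥0 : 0ℚ ≤ δ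
  δ≥0 = p≤q⇒0≤q-p (layering e* (proj₁ e*∈E×enters))

  shifted : Vect n
  shifted v = if U v then m v + δ else m v

  shifted-in : ∀ {v} → U v ≡ true → shifted v ≡ m v + δ
  shifted-in {v} = cong (λ b → if b then m v + δ else m v)

  shifted-out : ∀ {v} → U v ≡ false → shifted v ≡ m v
  shifted-out {v} = cong (λ b → if b then m v + δ else m v)

  shifted-layering : IsRationalLayering E shifted
  shifted-layering (t , h) e∈ = by-cases (U t) (U h) refl refl
    where
    open ≤-Reasoning
    d = m h - m t
    by-cases : ∀ a b → U t ≡ a → U h ≡ b → shifted h - shifted t ≤ 1ℚ
    by-cases true true Ut Uh = begin
      shifted h - shifted t  ≡⟨ cong₂ _-_ (shifted-in Uh) (shifted-in Ut) ⟩
      m h + δ - (m t + δ)    ≡⟨ solve 3 (λ a b c → a :+ c :- (b :+ c) := a :- b) refl (m h) (m t) δ ⟩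
      d                      ≤⟨ layering (t , h) e∈ ⟩
      1ℚ                     ∎
    by-cases false false Ut Uh = begin
      shifted h - shifted t  ≡⟨ cong₂ _-_ (shifted-out Uh) (shifted-out Ut) ⟩
      d                      ≤⟨ layering (t , h) e∈ ⟩
      1ℚ                     ∎
    by-cases false true Ut Uh = begin
      shifted h - shifted t  ≡⟨ cong₂ _-_ (shifted-in Uh) (shifted-out Ut) ⟩
      m h + δ - m t          ≡⟨ solve 3 (λ a b c → a :+ c :- b := a :- b :+ c) refl (m h) (m t) δ ⟩
      d + δ                  ≤⟨ +-monoʳ-≤ d (slack-minimal e∈ (Ut , Uh)) ⟩
      d + (1ℚ - d)           ≡⟨ solve 1 (λ d → d :+ (con 1ℚ :- d) := con 1ℚ) refl d ⟩
      1ℚ                     ∎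
    by-cases true false Ut Uh = begin
      shifted h - shifted t  ≡⟨ cong₂ _-_ (shifted-out Uh) (shifted-in Ut) ⟩
      m h - (m t + δ)        ≡⟨ solve 3 (λ a b c → a :- (b :+ c) := a :- b :- c) refl (m h) (m t) δ ⟩
      d - δ                  ≤⟨ +-monoʳ-≤ d (neg-antimono-≤ δ≥0) ⟩
      d - 0ℚ                 ≡⟨ +-identityʳ d ⟩
      d                      ≤⟨ layering (t , h) e∈ ⟩
      1ℚ                     ∎

  shifted-gain : ∀ x → 0ℚ ≤ fCut U x → m · x ≤ shifted · x
  shifted-gain x fCut≥0 = begin
    m · x                          ≡⟨ +-identityʳ (m · x) ⟨
    m · x + 0ℚ                     ≤⟨ +-monoʳ-≤ (m · x) (*-nonNeg δ≥0 fCut≥0) ⟩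
    m · x + δ * fCut U x           ≡⟨ cong (λ f → m · x + δ * f) (fCut≡χ· U x) ⟩
    m · x + δ * (χ U · x)          ≡⟨ cong (m · x +_) (·-scaleˡ δ (χ U) x) ⟨
    m · x + (λ v → δ * χ U v) · x  ≡⟨ ·-distribʳ-+ m (λ v → δ * χ U v) x ⟨
    (λ v → m v + δ * χ U v) · x    ≡⟨ sum-cong-≗ (λ v → cong (_* x v) (pointwise v (U v) refl)) ⟩
    shifted · x                    ∎
    where
    open ≤-Reasoning
    pointwise : ∀ v b → U v ≡ b → m v + δ * χ U v ≡ shifted v
    pointwise v true  Uv = begin-equality
      m v + δ * χ U v  ≡⟨ cong (λ b → m v + δ * (if b then 1ℚ else 0ℚ)) Uv ⟩
      m v + δ * 1ℚ     ≡⟨ cong (m v +_) (*-identityʳ δ) ⟩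
      m v + δ          ≡⟨ shifted-in Uv ⟨
      shifted v        ∎
    pointwise v false Uv = begin-equality
      m v + δ * χ U v  ≡⟨ cong (λ b → m v + δ * (if b then 1ℚ else 0ℚ)) Uv ⟩
      m v + δ * 0ℚ     ≡⟨ trans (cong (m v +_) (*-zeroʳ δ)) (+-identityʳ (m v)) ⟩
      m v              ≡⟨ shifted-out Uv ⟨
      shifted v        ∎

  shifted-preserves : ∀ {e} → ¬ Crosses U e → Tightℚ m e → Tightℚ shifted e
  shifted-preserves {t , h} uncut tight = by-cases (U t) (U h) refl refl
    where
    by-cases : ∀ a b → U t ≡ a → U h ≡ b → shifted h - shifted t ≡ 1ℚ
    by-cases true true Ut Uh = trans (cong₂ _-_ (shifted-in Uh) (shifted-in Ut))
      (trans (solve 3 (λ a b c → a :+ c :- (b :+ c) := a :- b) refl (m h) (m t) δ) tight)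
    by-cases false false Ut Uh = trans (cong₂ _-_ (shifted-out Uh) (shifted-out Ut)) tight
    by-cases true false Ut Uh = ⊥-elim (uncut (λ Ut≡Uh → true≢false (trans (sym Ut) (trans Ut≡Uh Uh))))
    by-cases false true Ut Uh = ⊥-elim (uncut (λ Ut≡Uh → true≢false (trans (sym Uh) (trans (sym Ut≡Uh) Ut))))

  e*-tight : Tightℚ shifted e*
  e*-tight = begin
    shifted h* - shifted t*  ≡⟨ cong₂ _-_ (shifted-in (proj₂ enters)) (shifted-out (proj₁ enters)) ⟩
    m h* + δ - m t*          ≡⟨ solve 2 (λ a b → a :+ (con 1ℚ :- (a :- b)) :- b := con 1ℚ)
                                       refl (m h*) (m t*) ⟩
    1ℚ                       ∎
    where
    open ≡-Reasoning
    t* = tail e*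
    h* = head e*
    enters = proj₂ e*∈E×enters

module _ {n : ℕ} {E : List (Edge n)} {x : Vect n} (rhs : InRHS E x) where

  directed-of-no-leaving : ∀ {U} → ¬ Any (Enters (not ∘ U)) E → DirectedToV1 E U
  directed-of-no-leaving {U} none (t , h) e∈ cross = by-cases (U t) (U h) refl refl
    where
    by-cases : ∀ a b → U t ≡ a → U h ≡ b → U t ≡ false × U h ≡ true
    by-cases false true  Ut Uh = Ut , Uh
    by-cases true  false Ut Uh = ⊥-elim (none (lose e∈ (cong not Ut , cong not Uh)))
    by-cases true  true  Ut Uh = ⊥-elim (cross (trans Ut (sym Uh)))
    by-cases false false Ut Uh = ⊥-elim (cross (trans Ut (sym Uh)))

  entering-of-no-leaving : ∀ {U} → IsCut E U → ¬ Any (Enters (not ∘ U)) E → Any (Enters U) E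
  entering-of-no-leaving cut none with find cut
  ... | e , e∈ , cross = lose e∈ (directed-of-no-leaving none e e∈ cross)

  entering-side : ∀ {S} → IsElementaryCut E S →
                  ∃ λ U → CutSubset E U S × 0ℚ ≤ fCut U x × Any (Enters U) E
  entering-side {S} elementary with any? (enters? (not ∘ S)) E | any? (enters? S) E
  ... | no none | _ =
    S , (λ _ _ → id) , proj₁ rhs S elementary (directed-of-no-leaving none) ,
    entering-of-no-leaving (proj₁ elementary) none
  ... | yes _ | no none =
    not ∘ S , (λ e _ → crosses-not⁻ {S = S} e) ,
    proj₁ rhs (not ∘ S) (elementary-not elementary) (directed-of-no-leaving none′) ,
    entering-of-no-leaving (proj₁ (elementary-not elementary)) none′
    where
    none′ : ¬ Any (Enters (not ∘ not ∘ S)) E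
    none′ = none ∘ Any.map (λ { {t , h} (St , Sh) → trans (sym (not-involutive (S t))) St ,
                                                     trans (sym (not-involutive (S h))) Sh })
  ... | yes leaving | yes entering with 0ℚ ≤? fCut S x
  ...   | yes fCut≥0 = S , (λ _ _ → id) , fCut≥0 , entering
  ...   | no fCut≱0  =
    not ∘ S , (λ e _ → crosses-not⁻ {S = S} e) ,
    subst (0ℚ ≤_) (sym (fCut-not S x (proj₂ (proj₂ rhs)))) (neg-antimono-≤ (<⇒≤ (≰⇒> fCut≱0))) ,
    leaving

module _ {n : ℕ} {E : List (Edge n)} {m : Vect n} {r : Fin n} (layering : IsRationalLayering E m)
         (spanning : ∀ u → WConn E (Tightℚ m) u r) where

  height : ∀ {u} → WConn E (Tightℚ m) u r → Σ ℤ λ z → z / 1 ≡ m u - m r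
  height here = ℤ.+ 0 , sym (+-inverseʳ (m r))
  height (fwd {u} {h} _ tight rest) with height rest
  ... | z , z≡ = z ℤ.- ℤ.+ 1 , (begin
    (z ℤ.- ℤ.+ 1) / 1        ≡⟨ /1-homo-‿- z (ℤ.+ 1) ⟩
    z / 1 - 1ℚ               ≡⟨ cong₂ _-_ z≡ (sym tight) ⟩
    m h - m r - (m h - m u)  ≡⟨ solve 3 (λ a b c → a :- b :- (a :- c) := c :- b) refl (m h) (m r) (m u) ⟩
    m u - m r                ∎)
    where open ≡-Reasoning
  height (bwd {t} {u} _ tight rest) with height rest
  ... | z , z≡ = z ℤ.+ ℤ.+ 1 , (begin
    (z ℤ.+ ℤ.+ 1) / 1        ≡⟨ /1-homo-+ z (ℤ.+ 1) ⟩
    z / 1 + 1ℚ               ≡⟨ cong₂ _+_ z≡ (sym tight) ⟩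
    m t - m r + (m u - m t)  ≡⟨ solve 3 (λ a b c → a :- b :+ (c :- a) := c :- b) refl (m t) (m r) (m u) ⟩
    m u - m r                ∎)
    where open ≡-Reasoning

  heights : Fin n → ℤ
  heights v = proj₁ (height (spanning v))

  heights-difference : ∀ t h → (heights h ℤ.- heights t) / 1 ≡ m h - m t
  heights-difference t h = begin
    (heights h ℤ.- heights t) / 1  ≡⟨ /1-homo-‿- (heights h) (heights t) ⟩
    heights h / 1 - heights t / 1  ≡⟨ cong₂ _-_ (proj₂ (height (spanning h))) (proj₂ (height (spanning t))) ⟩
    m h - m r - (m t - m r)        ≡⟨ solve 3 (λ a b c → a :- c :- (b :- c) := a :- b) refl (m h) (m t) (m r) ⟩
    m h - m t                      ∎
    where open ≡-Reasoning

  heights-admissible : IsAdmissibleLayering E heights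
  heights-admissible = steps≤1 , tightly-connected
    where
    steps≤1 : ∀ e → e ∈ E → heights (head e) ℤ.- heights (tail e) ℤ.≤ ℤ.+ 1
    steps≤1 (t , h) e∈ = /1-cancel-≤ (subst (_≤ 1ℚ) (sym (heights-difference t h)) (layering (t , h) e∈))

    tight-to-root : ∀ {u} → WConn E (Tightℚ m) u r → WConn E (Tight heights) u r
    tight-to-root = WConn-map (λ { {t , h} _ tight → /1-injective (trans (heights-difference t h) tight) })

    tightly-connected : ∀ u v → WConn E (Tight heights) u v
    tightly-connected u v = WConn-trans (tight-to-root (spanning u)) (WConn-sym (tight-to-root (spanning v)))

  dotℤ-heights : ∀ {x} → sumV x ≡ 0ℚ → dotℤ heights x ≡ m · x
  dotℤ-heights {x} ∑x≡0 = begin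
    dotℤ heights x                   ≡⟨ sumV≡sum (λ v → heights v / 1 * x v) ⟩
    (λ v → heights v / 1) · x        ≡⟨ sum-cong-≗ (λ v → cong (_* x v) (proj₂ (height (spanning v)))) ⟩
    (λ v → m v + - m r) · x          ≡⟨ ·-distribʳ-+ m (λ _ → - m r) x ⟩
    m · x + sum (λ v → - m r * x v)  ≡⟨ cong (m · x +_) (*-distribˡ-sum (- m r) x) ⟨
    m · x + - m r * sum x            ≡⟨ cong (λ s → m · x + - m r * s) (trans (sym (sumV≡sum x)) ∑x≡0) ⟩
    m · x + - m r * 0ℚ               ≡⟨ solve 2 (λ a b → a :+ (:- b) :* con 0ℚ := a) refl (m · x) (m r) ⟩
    m · x                            ∎
    where open ≡-Reasoning

⊃-of-crossing : ∀ {n} {K K′ : Fin n → Bool} {t h} →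
                K ⊆ K′ → Crosses K (t , h) → K′ t ≡ K′ h → K′ ⊃ K
⊃-of-crossing {K = K} {K′} {t} {h} K⊆K′ cross K′t≡K′h = by-cases (K t) (K h) refl refl
  where
  by-cases : ∀ a b → K t ≡ a → K h ≡ b → K′ ⊃ K
  by-cases true  false Kt Kh = K⊆K′ , h , Kh , trans (sym K′t≡K′h) (K⊆K′ t Kt)
  by-cases false true  Kt Kh = K⊆K′ , t , Kt , trans K′t≡K′h (K⊆K′ h Kh)
  by-cases true  true  Kt Kh = ⊥-elim (cross (trans Kt (sym Kh)))
  by-cases false false Kt Kh = ⊥-elim (cross (trans Kt (sym Kh)))

module _ {n : ℕ} {E : List (Edge n)} {x : Vect n} (connected : Connected E) (rhs : InRHS E x) (r : Fin n) where

  tight-component : (m : Vect n) → Component {E = E} (Tightℚ m) r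
  tight-component m = component (tight? m) r

  spanning⇒⊥ : ∀ {m} → IsRationalLayering E m → 1ℚ < m · x →
               (∀ v → Component.members (tight-component m) v ≡ true) → ⊥
  spanning⇒⊥ {m} layering separates spanning = <-irrefl refl (<-≤-trans separates (begin
    m · x     ≡⟨ dotℤ-heights {m = m} layering reach (proj₂ (proj₂ rhs)) ⟨
    dotℤ ℓ x  ≤⟨ proj₁ (proj₂ rhs) ℓ (heights-admissible {m = m} layering reach) ⟩
    1ℚ        ∎))
    where
    open ≤-Reasoning
    reach : ∀ u → WConn E (Tightℚ m) u r
    reach u = Component.reach (tight-component m) (spanning u)
    ℓ : Fin n → ℤ
    ℓ = heights {m = m} layering reach

  Improvement : Vect n → Set
  Improvement m = ∃ λ m′ → IsRationalLayering E m′ × 1ℚ < m′ · x ×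
                           Component.members (tight-component m′) ⊃ Component.members (tight-component m)

  shift-improves : ∀ {m} → IsRationalLayering E m → 1ℚ < m · x → ∀ U →
                   CutSubset E U (Component.members (tight-component m)) → 0ℚ ≤ fCut U x →
                   Any (Enters U) E → Improvement m
  shift-improves {m} layering separates U U-cut⊆K-cut fCut≥0 entering =
    shifted , shifted-layering , <-≤-trans separates (shifted-gain x fCut≥0) ,
    ⊃-of-crossing K⊆K′ (U-cut⊆K-cut e* e*∈E (enters⇒crosses {U = U} e* e*-enters)) (K′.closed e*∈E e*-tight)
    where
    open Shift {m = m} layering U entering
    module K  = Component (tight-component m)
    module K′ = Component (tight-component shifted)
    e*∈E = proj₁ e*∈E×enters
    e*-enters = proj₂ e*∈E×enters

    K⊆K′ : K.members ⊆ K′.members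
    K⊆K′ u Ku = trans (constant-along K′.closed (WConn-map still-tight (K.reach Ku))) K′.root
      where
      still-tight : ∀ {e} → e ∈ E → Tightℚ m e → Tightℚ shifted e
      still-tight {t , h} e∈ tight =
        shifted-preserves (λ cross → U-cut⊆K-cut (t , h) e∈ cross (K.closed e∈ tight)) tight

  improve : ∀ {m} → IsRationalLayering E m → 1ℚ < m · x →
            ∀ {v} → Component.members (tight-component m) v ≡ false → Improvement m
  improve {m} layering separates Kv =
    let U , U-cut⊆C-cut , fCut≥0 , entering = entering-side rhs C-elementary
    in shift-improves {m = m} layering separates U (λ e e∈ → C-cut⊆K-cut e e∈ ∘ U-cut⊆C-cut e e∈)
                      fCut≥0 entering
    where open OutsideComponent connected (tight-component m) Kv

  no-better-layering : ∀ m → IsRationalLayering E m → 1ℚ < m · x →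
                       Acc _⊃_ (Component.members (tight-component m)) → ⊥
  no-better-layering m layering separates (acc larger) = by-cases (all? (λ v → K.members v ≟ᵇ true))
    where
    module K = Component (tight-component m)
    by-cases : Dec (∀ v → K.members v ≡ true) → ⊥
    by-cases (yes spanning) = spanning⇒⊥ {m = m} layering separates spanning
    by-cases (no ¬spanning) =
      let v , Kv≢true = ¬∀⟶∃¬ n (λ v → K.members v ≡ true) (λ v → K.members v ≟ᵇ true) ¬spanning
          m′ , layering′ , separates′ , grows = improve {m = m} layering separates (¬-not Kv≢true)
      in no-better-layering m′ layering′ separates′ (larger grows)

no-separating-layering : ∀ {n} {E : List (Edge n)} {x : Vect n} →
                         Connected E → InRHS E x → ¬ SeparatingLayering E x
no-separating-layering {zero}  _ _ (_ , _ , separates) = <-asym separates (positive⁻¹ 1ℚ)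
no-separating-layering {suc n} {x = x} connected rhs (m , layering , separates) =
  no-better-layering {x = x} connected rhs zero m layering separates (⊃-wellFounded _)

proposition2p10 : (n : ℕ) (E : List (Edge n)) → Connected E →
    (x : Vect n) → (InQtilde E x → InRHS E x) × (InRHS E x → InQtilde E x)
proposition2p10 n E connected x = Qtilde⊆RHS E , RHS⊆Qtilde
  where
  RHS⊆Qtilde : InRHS E x → InQtilde E x
  RHS⊆Qtilde rhs with separation E x
  ... | inj₁ hull       = hull
  ... | inj₂ separating = ⊥-elim (no-separating-layering connected rhs separating)
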